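{- Let $H$ be a graph with connected components $H_1,\dots,H_\ell$. Then for every integer $k\geq 2$, $$f_k(n,H)=\Theta\left(\min_{i\in[\ell]} f_k(n,H_i)\right).$$
   Context: All colourings are edge-colourings of the complete graph $K_n$; a colouring is proper if any two edges sharing a vertex receive different colours. Two copies of a graph $H$ in an edge-coloured $K_n$ are colour isomorphic if there is a graph isomorphism between them mapping each edge to an edge of the same colour. A $k$-repeat of $H$ is a collection of $k$ pairwise vertex-disjoint, pairwise colour-isomorphic copies of $H$. For integers $k,n\geq 2$ and a graph $H$, $f_k(n,H)$ is the smallest integer $C$ such that there is a proper edge-colouring of $K_n$ with $C$ colours containing no $k$-repeat of $H$. Asymptotic notation is with respect to $n\to\infty$ with $H,k$ fixed. -}

module Defs where

open import Data.Nat using (ℕ; zero; suc; _<_; _⊓_)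
open import Data.Fin using (Fin; zero; suc)
open import Data.Product using (Σ; Σ-syntax; _×_; _,_)
open import Relation.Binary.PropositionalEquality using (_≡_; _≢_)
open import Relation.Nullary using (¬_)
open import Function.Definitions using (Injective)

record Graph : Set₁ where
  field
    V     : Set
    E     : V → V → Set
    E-sym : ∀ {u v} → E u v → E v u
    E-irr : ∀ {u} → ¬ E u u
open Graph public

record FinGraph : Set₁ where
  field
    order : ℕ
    adj   : Fin order → Fin order → Set
    adj-sym : ∀ {u v} → adj u v → adj v u
    adj-irr : ∀ {u} → ¬ adj u u
open FinGraph public

toGraph : FinGraph → Graph
toGraph G = record { V = Fin (order G) ; E = adj G ; E-sym = adj-sym G ; E-irr = adj-irr G }

-- walks and connectedness (a connected graph has at least one vertex)
data Walk (G : FinGraph) : Fin (order G) → Fin (order G) → Set where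
  here : ∀ {u} → Walk G u u
  step : ∀ {u v w} → adj G u v → Walk G v w → Walk G u w

Connected : FinGraph → Set
Connected G = Fin (order G) × (∀ u v → Walk G u v)

module _ {ℓ : ℕ} (Hs : Fin ℓ → FinGraph) where
  UV : Set
  UV = Σ (Fin ℓ) (λ i → Fin (order (Hs i)))

  data UE : UV → UV → Set where
    inE : ∀ {i u v} → adj (Hs i) u v → UE (i , u) (i , v)

  UE-sym : ∀ {x y} → UE x y → UE y x
  UE-sym (inE {i} e) = inE (adj-sym (Hs i) e)

  UE-irr : ∀ {x} → ¬ UE x x
  UE-irr (inE {i} e) = adj-irr (Hs i) e

  DisjUnion : Graph
  DisjUnion = record { V = UV ; E = UE ; E-sym = UE-sym ; E-irr = UE-irr }

-- edge-colourings of K_n with colours from Fin C (values on the diagonal are irrelevant)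
Colouring : ℕ → ℕ → Set
Colouring n C = Fin n → Fin n → Fin C

Proper : ∀ {n C} → Colouring n C → Set
Proper {n} c = (∀ x y → c x y ≡ c y x)
             × (∀ (x y z : Fin n) → x ≢ y → x ≢ z → y ≢ z → c x y ≢ c x z)

-- a k-repeat of H: k copies of H (injective maps V(H) → V(K_n)), pairwise
-- vertex-disjoint, and colour-isomorphic via the common parametrisation by H
KRepeat : ∀ {n C} → ℕ → Graph → Colouring n C → Set
KRepeat {n} k H c =
  Σ[ φ ∈ (Fin k → V H → Fin n) ]
      (∀ i → Injective _≡_ _≡_ (φ i))
    × (∀ i j → i ≢ j → ∀ u v → φ i u ≢ φ j v)
    × (∀ i j u v → E H u v → c (φ i u) (φ i v) ≡ c (φ j u) (φ j v))

Good : ℕ → ℕ → Graph → ℕ → Set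
Good k n H C = Σ[ c ∈ Colouring n C ] Proper c × ¬ KRepeat k H c

IsF : ℕ → ℕ → Graph → ℕ → Set
IsF k n H C = Good k n H C × (∀ C' → C' < C → ¬ Good k n H C')

minFin : ∀ m → (Fin (suc m) → ℕ) → ℕ
minFin zero    g = g zero
minFin (suc m) g = g zero ⊓ minFin m (λ i → g (suc i))

module Submission where

open import Defs
open import Data.Nat using (ℕ; suc; _≤_; _*_)
open import Data.Fin using (Fin)
open import Data.Product using (Σ; _×_)

open import Data.Nat using (zero; _+_; _<_; s≤s; _≤?_)
open import Data.Nat.Properties
  using (≤-refl; ≤-trans; ≤-<-trans; <-≤-trans; m≤m+n; m≤n+m; ≮⇒≥; ≰⇒>;
         m⊓n≤m; m⊓n≤n; ⊓-glb; +-assoc; *-distribˡ-+; *-identityˡ; *-monoˡ-≤)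
open import Data.Fin using (zero; suc; _↑ˡ_; _↑ʳ_; combine; remQuot) renaming (_≤_ to _≤ᶠ_)
import Data.Fin.Properties as Fin
open import Data.Vec.Functional using (_++_)
open import Data.Vec.Functional.Properties using (lookup-++ˡ; lookup-++ʳ)
open import Data.Product using (_,_; proj₁; proj₂; uncurry)
open import Data.Sum using (_⊎_; inj₁; inj₂)
open import Data.Empty using (⊥; ⊥-elim)
open import Relation.Nullary using (¬_; yes; no)
open import Relation.Nullary.Negation using (¬¬-map)
open import Relation.Nullary.Decidable using (decidable-stable)
open import Relation.Binary.PropositionalEquality
  using (_≡_; _≢_; refl; sym; trans; cong; cong₂; subst)
open import Function using (_∘_)

-- For H = H₁ ⊔ … ⊔ H_ℓ (each Hᵢ connected), f = f_k(n,H) and gᵢ = f_k(n,Hᵢ)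
-- we prove  f ≤ min gᵢ ≤ (1 + k·|V(H)|)·f  for all n ≥ 2.
-- Lower bound: a k-repeat of H restricts to one of each Hᵢ.
-- Upper bound: take an optimal colouring c for H and suppose every gⱼ exceeds
-- (1 + k·|V(H)|)·f.  Greedily find k-repeats of H₁, H₂, …, each avoiding the
-- B ≤ k·|V(H)| vertices already used; together they are a k-repeat of H in c.
-- To avoid the used vertices, refine c by marking each edge with the largest
-- label of a used endpoint: (1 + B)·f < gⱼ colours, so there is a k-repeat of
-- Hⱼ.  As Hⱼ has no isolated vertex (one-vertex graphs always repeat), a used
-- vertex in one copy forces the matching edge of every other copy to contain
-- the same used vertex, contradicting disjointness.
-- Only a doubly negated repeat follows from having fewer than f_k colours, so
-- the upper bound is proved by refutation and the greedy step is in
-- continuation-passing style.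

minFin-≤ : ∀ m g (i : Fin (suc m)) → minFin m g ≤ g i
minFin-≤ zero    g zero    = ≤-refl
minFin-≤ (suc m) g zero    = m⊓n≤m (g zero) _
minFin-≤ (suc m) g (suc i) = ≤-trans (m⊓n≤n (g zero) _) (minFin-≤ m (g ∘ suc) i)

minFin-glb : ∀ m g x → (∀ (i : Fin (suc m)) → x ≤ g i) → x ≤ minFin m g
minFin-glb zero    g x below = below zero
minFin-glb (suc m) g x below = ⊓-glb (below zero) (minFin-glb m (g ∘ suc) x (below ∘ suc))

least-colours : ∀ {k n C C'} {H : Graph} → IsF k n H C → Good k n H C' → C ≤ C'
least-colours (_ , minimal) good = ≮⇒≥ (λ C'<C → minimal _ C'<C good)

fewer-colours-repeat : ∀ {k n C C'} {H : Graph} → IsF k n H C → C' < C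
                     → (c : Colouring n C') → Proper c → ¬ ¬ KRepeat k H c
fewer-colours-repeat (_ , minimal) C'<C c proper noRepeat = minimal _ C'<C (c , proper , noRepeat)

restrict-repeat : ∀ {ℓ k n C} (Hs : Fin ℓ → FinGraph) (i : Fin ℓ) {c : Colouring n C}
                → KRepeat k (DisjUnion Hs) c → KRepeat k (toGraph (Hs i)) c
restrict-repeat Hs i (φ , inj , disj , col) =
    (λ a u → φ a (i , u))
  , (λ a eq → fibre (inj a eq))
  , (λ a b a≢b u v → disj a b a≢b (i , u) (i , v))
  , (λ a b u v e → col a b (i , u) (i , v) (inE e))
  where
    fibre : ∀ {u v : Fin (order (Hs i))} → _≡_ {A = UV Hs} (i , u) (i , v) → u ≡ v
    fibre refl = refl

good-component⇒good-union : ∀ {ℓ k n C} (Hs : Fin ℓ → FinGraph) (i : Fin ℓ)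
                          → Good k n (toGraph (Hs i)) C → Good k n (DisjUnion Hs) C
good-component⇒good-union Hs i (c , proper , noRepeat) =
  c , proper , λ R → noRepeat (restrict-repeat Hs i {c} R)

union-≤-components : ∀ {m k n F} (Hs : Fin (suc m) → FinGraph) (G : Fin (suc m) → ℕ)
                   → IsF k n (DisjUnion Hs) F → (∀ i → IsF k n (toGraph (Hs i)) (G i))
                   → F ≤ minFin m G
union-≤-components {m} Hs G isF isG = minFin-glb m G _ λ i →
  least-colours {H = DisjUnion Hs} isF (good-component⇒good-union Hs i (proj₁ (isG i)))

trivial-graph-repeat : ∀ {k C} (H : Graph) → (∀ (u v : V H) → u ≡ v)
                     → (c : Colouring (k + 2) C) → KRepeat k H c
trivial-graph-repeat H trivial c =
    (λ i _ → i ↑ˡ 2)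
  , (λ i {u} {v} _ → trivial u v)
  , (λ i j i≢j u v eq → i≢j (Fin.↑ˡ-injective 2 i j eq))
  , (λ i j u v e → ⊥-elim (E-irr H (subst (E H u) (sym (trivial u v)) e)))

fin-trivial-or-not : ∀ o → (∀ (u v : Fin o) → u ≡ v) ⊎ (∀ (u : Fin o) → Σ (Fin o) (u ≢_))
fin-trivial-or-not zero          = inj₁ (λ ())
fin-trivial-or-not (suc zero)    = inj₁ (λ { zero zero → refl })
fin-trivial-or-not (suc (suc o)) = inj₂ (λ { zero → suc zero , (λ ()) ; (suc u) → zero , (λ ()) })

first-edge : ∀ {H : FinGraph} {u w} → u ≢ w → Walk H u w → Σ (Fin (order H)) (adj H u)
first-edge u≢w here       = ⊥-elim (u≢w refl)
first-edge u≢w (step e _) = _ , e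

no-isolated-vertex : ∀ {k} (H : FinGraph) → Connected H → Σ ℕ (Good k (k + 2) (toGraph H))
                   → ∀ u → Σ (Fin (order H)) (adj H u)
no-isolated-vertex H (_ , walk) (_ , c , _ , noRepeat) with fin-trivial-or-not (order H)
... | inj₁ trivial = ⊥-elim (noRepeat (trivial-graph-repeat (toGraph H) trivial c))
... | inj₂ other   = λ u → first-edge (proj₂ (other u)) (walk u (proj₁ (other u)))

-- Repeats avoiding a set of used vertices, given as the image of emb.
Avoids : ∀ {B n k} {X : Set} → (Fin B → Fin n) → (Fin k → X → Fin n) → Set
Avoids {B} {k = k} {X} emb φ = ∀ (p : Fin B) (i : Fin k) (x : X) → emb p ≢ φ i x

AvoidingRepeat : ∀ {n C B} → ℕ → Graph → Colouring n C → (Fin B → Fin n) → Set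
AvoidingRepeat k H c emb = Σ (KRepeat k H c) λ R → Avoids emb (proj₁ R)

copies : ∀ {k o n} → (Fin k → Fin o → Fin n) → Fin (k * o) → Fin n
copies {o = o} ψ = uncurry ψ ∘ remQuot o

avoids-++ : ∀ {B B' n k} {X : Set} (f : Fin B → Fin n) (g : Fin B' → Fin n)
            {φ : Fin k → X → Fin n} → Avoids (f ++ g) φ → Avoids f φ × Avoids g φ
avoids-++ {B} {B'} f g avoid =
    (λ p i x eq → avoid (p ↑ˡ B') i x (trans (lookup-++ˡ f g p) eq))
  , (λ p i x eq → avoid (B ↑ʳ p) i x (trans (lookup-++ʳ f g p) eq))

avoids-copies : ∀ {B k o n} {X : Set} (ψ : Fin k → Fin o → Fin n) {φ : Fin B → X → Fin n}
              → Avoids (copies ψ) φ → ∀ i u j x → ψ i u ≢ φ j x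
avoids-copies ψ avoid i u j x eq =
  avoid (combine i u) j x (trans (cong (uncurry ψ) (Fin.remQuot-combine i u)) eq)

another-index : ∀ {k} → 2 ≤ k → (i : Fin k) → Σ (Fin k) (i ≢_)
another-index (s≤s (s≤s _)) zero    = suc zero , λ ()
another-index (s≤s (s≤s _)) (suc i) = zero , λ ()

module Marking {n C B : ℕ} (c : Colouring n C) (emb : Fin B → Fin n) where
  open import Algebra.Construct.NaturalChoice.Max (Fin.≤-totalOrder (suc B))
    using (_⊔_; ⊔-comm; ⊔-sel; x≤x⊔y)

  label : Fin n → Fin (suc B)
  label x with Fin.any? (λ p → emb p Fin.≟ x)
  ... | yes (p , _) = suc p
  ... | no _        = zero

  label-sound : ∀ x r → label x ≡ suc r → emb r ≡ x
  label-sound x r eq with Fin.any? (λ p → emb p Fin.≟ x)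
  label-sound x r refl | yes (_ , embp≡x) = embp≡x

  label-used : ∀ p → Σ (Fin B) λ r → label (emb p) ≡ suc r
  label-used p with Fin.any? (λ q → emb q Fin.≟ emb p)
  ... | yes (r , _) = r , refl
  ... | no unused   = ⊥-elim (unused (p , refl))

  marker : Fin n → Fin n → Fin (suc B)
  marker x y = label x ⊔ label y

  marker-endpoint : ∀ x y r → marker x y ≡ suc r → emb r ≡ x ⊎ emb r ≡ y
  marker-endpoint x y r eq with ⊔-sel (label x) (label y)
  ... | inj₁ isLeft  = inj₁ (label-sound x r (trans (sym isLeft) eq))
  ... | inj₂ isRight = inj₂ (label-sound y r (trans (sym isRight) eq))

  marker-used : ∀ p y → Σ (Fin B) λ r → marker (emb p) y ≡ suc r
  marker-used p y with label-used p
  ... | r , eq = above (subst (_≤ᶠ marker (emb p) y) eq (x≤x⊔y (label (emb p)) (label y)))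
    where
      above : ∀ {r : Fin B} {a : Fin (suc B)} → suc r ≤ᶠ a → Σ (Fin B) λ s → a ≡ suc s
      above {a = suc s} _ = s , refl

  recolour : Colouring n (suc B * C)
  recolour x y = combine (marker x y) (c x y)

  same-colour : ∀ {x y x' y'} → recolour x y ≡ recolour x' y'
              → marker x y ≡ marker x' y' × c x y ≡ c x' y'
  same-colour eq = Fin.combine-injective _ _ _ _ eq

  recolour-proper : Proper c → Proper recolour
  recolour-proper (symmetric , distinct) =
      (λ x y → cong₂ combine (⊔-comm (label x) (label y)) (symmetric x y))
    , (λ x y z x≢y x≢z y≢z eq → distinct x y z x≢y x≢z y≢z (proj₂ (same-colour eq)))

  recolour-repeat : ∀ {k} (H : Graph) → 2 ≤ k → (∀ u → Σ (V H) (E H u))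
                  → KRepeat k H recolour → AvoidingRepeat k H c emb
  recolour-repeat {k} H k≥2 neighbour (ψ , inj , disj , col) =
    (ψ , inj , disj , λ i j u v e → proj₂ (same-colour (col i j u v e))) , avoids
    where
      clash : ∀ {x i j} → i ≢ j → Σ (V H) (λ u → x ≡ ψ i u) → Σ (V H) (λ u → x ≡ ψ j u) → ⊥
      clash i≢j (u , inI) (u' , inJ) = disj _ _ i≢j u u' (trans (sym inI) inJ)

      endpoint : ∀ {x i a b} → x ≡ ψ i a ⊎ x ≡ ψ i b → Σ (V H) (λ u → x ≡ ψ i u)
      endpoint (inj₁ eq) = _ , eq
      endpoint (inj₂ eq) = _ , eq

      avoids : Avoids emb ψ
      avoids p i u used = clash j≢
          (endpoint (marker-endpoint (ψ i u) (ψ i v) r markI))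
          (endpoint (marker-endpoint (ψ j u) (ψ j v) r (trans (sym sameMarker) markI)))
        where
          v : V H
          v = proj₁ (neighbour u)
          j : Fin k
          j = proj₁ (another-index k≥2 i)
          j≢ : i ≢ j
          j≢ = proj₂ (another-index k≥2 i)
          r : Fin B
          r = proj₁ (marker-used p (ψ i v))
          markI : marker (ψ i u) (ψ i v) ≡ suc r
          markI = subst (λ x → marker x (ψ i v) ≡ suc r) used (proj₂ (marker-used p (ψ i v)))
          sameMarker : marker (ψ i u) (ψ i v) ≡ marker (ψ j u) (ψ j v)
          sameMarker = proj₁ (same-colour (col i j u v (proj₂ (neighbour u))))

avoiding-repeat-exists : ∀ {k n C B G} (H : Graph) → 2 ≤ k → (∀ u → Σ (V H) (E H u))
                       → IsF k n H G → suc B * C < G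
                       → (c : Colouring n C) → Proper c → (emb : Fin B → Fin n)
                       → ¬ ¬ AvoidingRepeat k H c emb
avoiding-repeat-exists H k≥2 neighbour isF few c proper emb =
  ¬¬-map (recolour-repeat H k≥2 neighbour)
         (fewer-colours-repeat {H = H} isF few recolour (recolour-proper proper))
  where open Marking c emb

size : ∀ {ℓ} → (Fin ℓ → FinGraph) → ℕ
size {zero}  Hs = 0
size {suc ℓ} Hs = order (Hs zero) + size (Hs ∘ suc)

module Greedy {k n C : ℕ} (c : Colouring n C) where

  empty-union-repeat : ∀ {B} (Hs : Fin zero → FinGraph) (emb : Fin B → Fin n)
                     → AvoidingRepeat k (DisjUnion Hs) c emb
  empty-union-repeat Hs emb =
    ((λ _ ()) , (λ { _ {() , _} }) , (λ { _ _ _ (() , _) _ }) , (λ { _ _ _ _ (inE {()} _) }))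
    , λ { _ _ (() , _) }

  join : ∀ {ℓ B} (Hs : Fin (suc ℓ) → FinGraph) (emb : Fin B → Fin n)
       → (R : AvoidingRepeat k (toGraph (Hs zero)) c emb)
       → AvoidingRepeat k (DisjUnion (Hs ∘ suc)) c (emb ++ copies (proj₁ (proj₁ R)))
       → AvoidingRepeat k (DisjUnion Hs) c emb
  join Hs emb ((ψ , inj₀ , disj₀ , col₀) , avoid₀) ((φ , injᵣ , disjᵣ , colᵣ) , avoidᵣ) =
    (χ , inj , disj , col) , avoid
    where
      old : Avoids emb φ
      old = proj₁ (avoids-++ emb (copies ψ) avoidᵣ)
      apart : ∀ i u j x → ψ i u ≢ φ j x
      apart = avoids-copies ψ (proj₂ (avoids-++ emb (copies ψ) avoidᵣ))

      χ : Fin k → UV Hs → Fin n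
      χ i (zero  , u) = ψ i u
      χ i (suc j , u) = φ i (j , u)

      inj : ∀ i {x y} → χ i x ≡ χ i y → x ≡ y
      inj i {zero  , u} {zero  , v} eq = cong (zero ,_) (inj₀ i eq)
      inj i {zero  , u} {suc j , v} eq = ⊥-elim (apart i u i (j , v) eq)
      inj i {suc j , u} {zero  , v} eq = ⊥-elim (apart i v i (j , u) (sym eq))
      inj i {suc j , u} {suc _ , v} eq with injᵣ i eq
      ... | refl = refl

      disj : ∀ i i' → i ≢ i' → ∀ x y → χ i x ≢ χ i' y
      disj i i' i≢i' (zero  , u) (zero  , v) = disj₀ i i' i≢i' u v
      disj i i' i≢i' (zero  , u) (suc j , v) = apart i u i' (j , v)
      disj i i' i≢i' (suc j , u) (zero  , v) = apart i' v i (j , u) ∘ sym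
      disj i i' i≢i' (suc j , u) (suc _ , v) = disjᵣ i i' i≢i' (j , u) (_ , v)

      col : ∀ i i' x y → UE Hs x y → c (χ i x) (χ i y) ≡ c (χ i' x) (χ i' y)
      col i i' _ _ (inE {zero}  e) = col₀ i i' _ _ e
      col i i' _ _ (inE {suc j} e) = colᵣ i i' _ _ (inE e)

      avoid : Avoids emb χ
      avoid p i (zero  , u) = avoid₀ p i u
      avoid p i (suc j , u) = old p i (j , u)

  greedy : ∀ {ℓ B} (Hs : Fin ℓ → FinGraph) (emb : Fin B → Fin n) (Btot : ℕ)
         → B + k * size Hs ≤ Btot
         → (∀ j {B'} (emb' : Fin B' → Fin n) → B' ≤ Btot
              → ¬ ¬ AvoidingRepeat k (toGraph (Hs j)) c emb')
         → ¬ ¬ AvoidingRepeat k (DisjUnion Hs) c emb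
  greedy {zero}      Hs emb Btot _     _     noRepeat = noRepeat (empty-union-repeat Hs emb)
  greedy {suc ℓ} {B} Hs emb Btot bound comps noRepeat =
    comps zero emb (≤-trans (m≤m+n B _) bound) λ R →
      greedy (Hs ∘ suc) (emb ++ copies (proj₁ (proj₁ R))) Btot bound' (comps ∘ suc)
        (noRepeat ∘ join Hs emb R)
    where
      o rest : ℕ
      o = order (Hs zero)
      rest = size (Hs ∘ suc)
      bound' : B + k * o + k * rest ≤ Btot
      bound' = subst (_≤ Btot) (sym (trans (+-assoc B _ _) (cong (B +_) (sym (*-distribˡ-+ k o rest)))))
                 bound

components-≤-union : ∀ {m k n F} (Hs : Fin (suc m) → FinGraph) (G : Fin (suc m) → ℕ)
                   → 2 ≤ k → (∀ i u → Σ (Fin (order (Hs i))) (adj (Hs i) u))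
                   → IsF k n (DisjUnion Hs) F → (∀ i → IsF k n (toGraph (Hs i)) (G i))
                   → minFin m G ≤ suc (k * size Hs) * F
components-≤-union {m} {k} {F = F} Hs G k≥2 neighbour ((c , proper , noRepeat) , _) isG =
  decidable-stable (_ ≤? _) λ min≰ →
    -- greedy from the empty set of used vertices
    greedy Hs (λ ()) Btot ≤-refl (component (≰⇒> min≰)) (noRepeat ∘ proj₁)
  where
    open Greedy c
    Btot : ℕ
    Btot = k * size Hs
    component : suc Btot * F < minFin m G → ∀ j {B} emb → B ≤ Btot
              → ¬ ¬ AvoidingRepeat k (toGraph (Hs j)) c emb
    component few j emb B≤ =
      avoiding-repeat-exists (toGraph (Hs j)) k≥2 (neighbour j) (isG j)
        (≤-<-trans (*-monoˡ-≤ F (s≤s B≤)) (<-≤-trans few (minFin-≤ m G j))) c proper emb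

lemma2p2 : (m : ℕ) (Hs : Fin (suc m) → FinGraph) → (∀ i → Connected (Hs i))
         → (k : ℕ) → 2 ≤ k
         → (F : ℕ → ℕ) (G : Fin (suc m) → ℕ → ℕ)
         → (∀ n → 2 ≤ n → IsF k n (DisjUnion Hs) (F n))
         → (∀ i n → 2 ≤ n → IsF k n (toGraph (Hs i)) (G i n))
         → Σ ℕ λ a → Σ ℕ λ b → Σ ℕ λ N → ∀ n → N ≤ n
             → (F n ≤ b * minFin m (λ i → G i n)) × (minFin m (λ i → G i n) ≤ a * F n)
lemma2p2 m Hs connected k k≥2 F G isF isG = suc (k * size Hs) , 1 , 2 , λ n n≥2 →
    subst (F n ≤_) (sym (*-identityˡ _))
      (union-≤-components Hs (λ i → G i n) (isF n n≥2) (λ i → isG i n n≥2))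
  , components-≤-union Hs (λ i → G i n) k≥2 neighbour (isF n n≥2) (λ i → isG i n n≥2)
  where
    -- Each component admits a k-repeat-free colouring of K_{k+2}, hence is nontrivial.
    neighbour : ∀ i u → Σ (Fin (order (Hs i))) (adj (Hs i) u)
    neighbour i = no-isolated-vertex (Hs i) (connected i)
                    (G i (k + 2) , proj₁ (isG i (k + 2) (m≤n+m 2 k)))
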